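{- For every $k\ge 2$, any deterministic $k$-way branching program computing $\mathrm{SumMod}^3_2(k)$ has at least $k^3$ states.
   Context: $T^3_2$ is the balanced rooted binary tree with 3 levels, nodes numbered heap-style: root $1$, children of $i$ are $2i,2i+1$ (leaves $4,5,6,7$). An input of $\mathrm{SumMod}^3_2(k)$ assigns to nodes $2$ and $3$ functions $f_2,f_3:[k]^2\to[k]$ (each given by its $k^2$ values, each a $k$-ary input variable) and to each leaf an element of $[k]$ (one variable each); the root function is fixed to be addition modulo $k$ (identifying $[k]$ with $\mathbb{Z}/k\mathbb{Z}$). Values: $v_i$ is the leaf label for a leaf and $v_i=f_i(v_{2i},v_{2i+1})$ for $i=2,3$; the output is $v_2+v_3 \bmod k$. A deterministic $k$-way branching program computing $g:[k]^m\to R$ is a directed rooted multigraph of states; each nonfinal state is labelled by a variable index and has exactly $k$ outedges labelled $1,\dots,k$; $|R|$ final sink states are labelled by elements of $R$; on input $x$ the computation starts at the root, follows from a state labelled $j$ the edge labelled $x_j$, and must reach the final state labelled $g(x)$. -}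

module Defs where

open import Data.Nat using (ℕ; zero; suc; _+_)
open import Data.Nat.DivMod using (_mod_)
open import Data.Fin using (Fin; toℕ)
open import Data.Sum using (_⊎_; inj₁; inj₂)
open import Data.Product using (∃)
open import Relation.Binary.PropositionalEquality using (_≡_)

-- A program with input variables of type V (each ranging over [k] ≅ Fin k)
-- and output set R = Fin r has n nonfinal states (Fin n) and exactly r
-- final sink states, one labelled by each element of R.  A state is thus
-- an element of  Fin n ⊎ Fin r  (inj₂ y = the final state labelled y).
-- Every nonfinal state carries a variable label and k outedges labelled
-- by Fin k (edge labels 1..k correspond to 0..k-1).

record BP (k : ℕ) (V : Set) (r : ℕ) : Set where
  field
    n    : ℕ
    var  : Fin n → V
    next : Fin n → Fin k → Fin n ⊎ Fin r
    root : Fin n ⊎ Fin r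

module _ {k : ℕ} {V : Set} {r : ℕ} (P : BP k V r) where
  open BP P

  step : (V → Fin k) → Fin n ⊎ Fin r → Fin n ⊎ Fin r
  step x (inj₁ s) = next s (x (var s))
  step x (inj₂ y) = inj₂ y

  run : ℕ → (V → Fin k) → Fin n ⊎ Fin r
  run zero    x = root
  run (suc t) x = step x (run t x)

  Computes : ((V → Fin k) → Fin r) → Set
  Computes g = ∀ x → ∃ λ t → run t x ≡ inj₂ (g x)

  numStates : ℕ
  numStates = n + r

-- input variables: the k^2 values of f₂, the k^2 values of f₃,
-- and the labels of the four leaves 4,5,6,7
data Var (k : ℕ) : Set where
  f₂ : Fin k → Fin k → Var k
  f₃ : Fin k → Fin k → Var k
  ℓ₄ ℓ₅ ℓ₆ ℓ₇ : Var k

addMod : {k : ℕ} → Fin k → Fin k → Fin k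
addMod {suc k} a b = (toℕ a + toℕ b) mod suc k

sumMod : (k : ℕ) → (Var k → Fin k) → Fin k
sumMod k x = addMod v₂ v₃
  where
    v₂ = x (f₂ (x ℓ₄) (x ℓ₅))
    v₃ = x (f₃ (x ℓ₆) (x ℓ₇))

module Submission where

-- For a, b, p, q ∈ [k] let  hard a b p q  be the input whose
-- leaves are labelled a, b, a, b, with f₂(a,b) = p, f₃(a,b) = q and every
-- other value of f₂, f₃ fixed; its output is p + q mod k.  Call the two
-- variables f₂(a,b), f₃(a,b) hidden.  The computation on hard a b p q must
-- read a hidden variable (otherwise the output would not depend on p); let
-- s be the LAST state on the path that reads one, and map (a,b,p,q) to
-- (s, value read at s).  This map [k]⁴ → (nonfinal states) × [k] is
-- injective: the variable at s determines a, b and whether it is f₂(a,b)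
-- or f₃(a,b); the value read determines the corresponding one of p, q;
-- and since the rest of the computation reads no hidden variable, the two
-- inputs produce the same output p + q, which determines the other one.
-- Hence k⁴ ≤ n·k, i.e. k³ ≤ n ≤ numStates.

open import Defs
open import Data.Nat using (ℕ; zero; suc; _≤_; _<_; _^_; _+_; _*_; _∸_; _%_; s≤s)
open import Data.Nat.Properties
  using (≤-trans; m≤m+n; *-cancelʳ-≤; *-comm; *-identityʳ; +-assoc; +-comm; m∸n+n≡m; <⇒≤)
open import Data.Nat.DivMod using (_mod_; [m+n]%n≡m%n; m<n⇒m%n≡m; %-distribˡ-+)
open import Data.Fin using (Fin; toℕ; _≟_)
import Data.Fin.Properties as Fin
open import Data.Maybe using (Maybe; just; nothing; maybe′)
open import Data.Sum using (_⊎_; inj₁; inj₂)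
open import Data.Product using (∃; _×_; _,_; proj₁; proj₂)
open import Data.Empty using (⊥; ⊥-elim)
open import Function.Bundles using (_↔_; _↣_; mk↣; Injection)
open import Function.Construct.Composition using (_↣-∘_; _↔-∘_)
open import Function.Properties.Inverse using (↔-refl; ↔-sym; ↔⇒↣)
open import Data.Product.Function.NonDependent.Propositional using (_×-↔_)
open import Relation.Nullary using (¬_; Dec; yes; no)
open import Relation.Nullary.Decidable using (_×-dec_)
open import Relation.Binary.PropositionalEquality

module Paths {k : ℕ} {V : Set} {r : ℕ} (P : BP k V r) where
  open BP P

  State : Set
  State = Fin n ⊎ Fin r

  data HaltsAvoiding (H : V → Set) (x : V → Fin k) : State → Fin r → Set where
    halt : ∀ o → HaltsAvoiding H x (inj₂ o) o
    read : ∀ s {o} → ¬ H (var s) →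
           HaltsAvoiding H x (next s (x (var s))) o → HaltsAvoiding H x (inj₁ s) o

  Halts : (V → Fin k) → State → Fin r → Set
  Halts = HaltsAvoiding (λ _ → ⊥)

  forget : ∀ {H x σ o} → HaltsAvoiding H x σ o → Halts x σ o
  forget (halt o)        = halt o
  forget (read s _ rest) = read s (λ ()) (forget rest)

  halts-step : ∀ {x σ o} → Halts x (step P x σ) o → Halts x σ o
  halts-step {σ = inj₁ s} h = read s (λ ()) h
  halts-step {σ = inj₂ _} h = h

  halts-run : ∀ {x o} t → Halts x (run P t x) o → Halts x root o
  halts-run zero    h = h
  halts-run (suc t) h = halts-run t (halts-step h)

  computes⇒halts : ∀ {g} → Computes P g → ∀ x → Halts x root (g x)
  computes⇒halts {g} computes x =
    halts-run t (subst (λ σ → Halts x σ (g x)) (sym reached) (halt (g x)))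
    where
      t : ℕ
      t = proj₁ (computes x)
      reached : run P t x ≡ inj₂ (g x)
      reached = proj₂ (computes x)

  outputs-agree : ∀ {H x y σ o o'} → (∀ v → ¬ H v → x v ≡ y v) →
                  HaltsAvoiding H x σ o → Halts y σ o' → o ≡ o'
  outputs-agree agree (halt o) (halt .o) = refl
  outputs-agree {y = y} {o' = o'} agree (read s visible rest) (read .s _ rest') =
    outputs-agree agree rest
      (subst (λ c → Halts y (next s c) o') (sym (agree (var s) visible)) rest')

  record LastQuery (H : V → Set) (x : V → Fin k) (o : Fin r) : Set where
    constructor lastQuery
    field
      state      : Fin n
      queried    : H (var state)
      afterwards : HaltsAvoiding H x (next state (x (var state))) o

  last-query : ∀ {H x σ o} → (∀ v → Dec (H v)) → Halts x σ o →
               HaltsAvoiding H x σ o ⊎ LastQuery H x o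
  last-query H? (halt o) = inj₁ (halt o)
  last-query H? (read s _ rest) with last-query H? rest
  ... | inj₂ later = inj₂ later
  ... | inj₁ avoids with H? (var s)
  ...   | yes hidden  = inj₂ (lastQuery s hidden avoids)
  ...   | no  visible = inj₁ (read s visible avoids)

module Arithmetic (m : ℕ) where
  private
    k : ℕ
    k = suc m

  inverse-cancels : ∀ a b → a ≤ k → b < k → ((k ∸ a) + (a + b)) % k ≡ b
  inverse-cancels a b a≤k b<k = begin
    ((k ∸ a) + (a + b)) % k ≡⟨ cong (_% k) (sym (+-assoc (k ∸ a) a b)) ⟩
    ((k ∸ a + a) + b) % k   ≡⟨ cong (λ w → (w + b) % k) (m∸n+n≡m a≤k) ⟩
    (k + b) % k             ≡⟨ cong (_% k) (+-comm k b) ⟩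
    (b + k) % k             ≡⟨ [m+n]%n≡m%n b k ⟩
    b % k                   ≡⟨ m<n⇒m%n≡m b<k ⟩
    b                       ∎
    where open ≡-Reasoning

  +-cancelˡ-% : ∀ a b c → a ≤ k → b < k → c < k →
                (a + b) % k ≡ (a + c) % k → b ≡ c
  +-cancelˡ-% a b c a≤k b<k c<k eq = begin
    b                                 ≡⟨ sym (inverse-cancels a b a≤k b<k) ⟩
    ((k ∸ a) + (a + b)) % k           ≡⟨ %-distribˡ-+ (k ∸ a) (a + b) k ⟩
    ((k ∸ a) % k + (a + b) % k) % k   ≡⟨ cong (λ w → ((k ∸ a) % k + w) % k) eq ⟩
    ((k ∸ a) % k + (a + c) % k) % k   ≡⟨ sym (%-distribˡ-+ (k ∸ a) (a + c) k) ⟩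
    ((k ∸ a) + (a + c)) % k           ≡⟨ inverse-cancels a c a≤k c<k ⟩
    c                                 ∎
    where open ≡-Reasoning

  addMod-cancelˡ : ∀ (p q q' : Fin k) → addMod p q ≡ addMod p q' → q ≡ q'
  addMod-cancelˡ p q q' eq = Fin.toℕ-injective
    (+-cancelˡ-% (toℕ p) (toℕ q) (toℕ q') (<⇒≤ (Fin.toℕ<n p)) (Fin.toℕ<n q) (Fin.toℕ<n q')
      (trans (sym (Fin.toℕ-fromℕ< _)) (trans (cong toℕ eq) (Fin.toℕ-fromℕ< _))))

  addMod-comm : ∀ (p q : Fin k) → addMod p q ≡ addMod q p
  addMod-comm p q = cong (_mod k) (+-comm (toℕ p) (toℕ q))

  addMod-cancelʳ : ∀ (p p' q : Fin k) → addMod p q ≡ addMod p' q → p ≡ p'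
  addMod-cancelʳ p p' q eq =
    addMod-cancelˡ q p p' (trans (addMod-comm q p) (trans eq (addMod-comm p' q)))

module HardInputs {k : ℕ} where

  data Inner : Set where
    node₂ node₃ : Inner

  nodeVar : Inner → Fin k → Fin k → Var k
  nodeVar node₂ = f₂
  nodeVar node₃ = f₃

  nodeVar-injective : ∀ {c c' a a' b b'} → nodeVar c a b ≡ nodeVar c' a' b' →
                      c ≡ c' × a ≡ a' × b ≡ b'
  nodeVar-injective {node₂} {node₂} refl = refl , refl , refl
  nodeVar-injective {node₃} {node₃} refl = refl , refl , refl
  nodeVar-injective {node₂} {node₃} ()
  nodeVar-injective {node₃} {node₂} ()

  pick : Inner → Fin k → Fin k → Fin k
  pick node₂ p q = p
  pick node₃ p q = q

  when : ∀ {A : Set} → Dec A → Inner → Maybe Inner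
  when (yes _) c = just c
  when (no _)  c = nothing

  slot : Fin k → Fin k → Var k → Maybe Inner
  slot a b (f₂ c d) = when (c ≟ a ×-dec d ≟ b) node₂
  slot a b (f₃ c d) = when (c ≟ a ×-dec d ≟ b) node₃
  slot a b ℓ₄ = nothing
  slot a b ℓ₅ = nothing
  slot a b ℓ₆ = nothing
  slot a b ℓ₇ = nothing

  slot-nodeVar : ∀ c a b → slot a b (nodeVar c a b) ≡ just c
  slot-nodeVar node₂ a b with a ≟ a ×-dec b ≟ b
  ... | yes _ = refl
  ... | no ¬eq = ⊥-elim (¬eq (refl , refl))
  slot-nodeVar node₃ a b with a ≟ a ×-dec b ≟ b
  ... | yes _ = refl
  ... | no ¬eq = ⊥-elim (¬eq (refl , refl))

  slot-just : ∀ {a b c} v → slot a b v ≡ just c → v ≡ nodeVar c a b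
  slot-just {a} {b} (f₂ d e) eq with d ≟ a ×-dec e ≟ b | eq
  ... | yes (refl , refl) | refl = refl
  slot-just {a} {b} (f₃ d e) eq with d ≟ a ×-dec e ≟ b | eq
  ... | yes (refl , refl) | refl = refl

  Hidden : Fin k → Fin k → Var k → Set
  Hidden a b v = ∃ λ c → v ≡ nodeVar c a b

  hidden? : ∀ a b v → Dec (Hidden a b v)
  hidden? a b v with slot a b v in eq
  ... | just c  = yes (c , slot-just v eq)
  ... | nothing = no λ { (c , refl) → nothing≢just (trans (sym eq) (slot-nodeVar c a b)) }
    where
      nothing≢just : ∀ {c} → ¬ (nothing ≡ just c)
      nothing≢just ()

  -- Leaf labels a, b, a, b; off the hidden variables f₂ and f₃ are
  -- constant (any fixed value would do; we use a).
  background : Fin k → Fin k → Var k → Fin k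
  background a b ℓ₄ = a
  background a b ℓ₅ = b
  background a b ℓ₆ = a
  background a b ℓ₇ = b
  background a b (f₂ _ _) = a
  background a b (f₃ _ _) = a

  hard : Fin k → Fin k → Fin k → Fin k → Var k → Fin k
  hard a b p q v = maybe′ (λ c → pick c p q) (background a b v) (slot a b v)

  hard-hidden : ∀ a b p q c → hard a b p q (nodeVar c a b) ≡ pick c p q
  hard-hidden a b p q c rewrite slot-nodeVar c a b = refl

  hard-visible : ∀ a b p q p' q' v → ¬ Hidden a b v → hard a b p q v ≡ hard a b p' q' v
  hard-visible a b p q p' q' v visible with slot a b v in eq
  ... | nothing = refl
  ... | just c  = ⊥-elim (visible (c , slot-just v eq))

  -- The leaves select exactly the hidden variables, so the output is p + q.
  sumMod-hard : ∀ a b p q → sumMod k (hard a b p q) ≡ addMod p q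
  sumMod-hard a b p q = cong₂ addMod (hard-hidden a b p q node₂) (hard-hidden a b p q node₃)

injection⇒≤ : ∀ {a b} {A B : Set} → Fin a ↔ A → Fin b ↔ B → A ↣ B → a ≤ b
injection⇒≤ finA finB f =
  Fin.injective⇒≤ (Injection.injective (↔⇒↣ (↔-sym finB) ↣-∘ (f ↣-∘ ↔⇒↣ finA)))

module LowerBound (m : ℕ) (P : BP (suc (suc m)) (Var (suc (suc m))) (suc (suc m)))
                  (computes : Computes P (sumMod (suc (suc m)))) where
  open BP P
  open Paths P
  open Arithmetic (suc m)
  open HardInputs {suc (suc m)}

  private
    k : ℕ
    k = suc (suc m)

  Quad : Set
  Quad = Fin k × Fin k × Fin k × Fin k

  -- The computation on hard a b p q must read a hidden variable: otherwise
  -- its output p + q would be the same for every p.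
  critical : ∀ a b p q → LastQuery (Hidden a b) (hard a b p q) (sumMod k (hard a b p q))
  critical a b p q
    with last-query (hidden? a b) (computes⇒halts computes (hard a b p q))
  ... | inj₂ found   = found
  ... | inj₁ avoids  = ⊥-elim (Fin.0≢1+n (trans (sym (p≡ Fin.zero)) (p≡ (Fin.suc Fin.zero))))
    where
      p≡ : ∀ p' → p ≡ p'
      p≡ p' = addMod-cancelʳ p p' q (begin
        addMod p q                  ≡⟨ sym (sumMod-hard a b p q) ⟩
        sumMod k (hard a b p q)     ≡⟨ outputs-agree (hard-visible a b p q p' q) avoids
                                         (computes⇒halts computes (hard a b p' q)) ⟩
        sumMod k (hard a b p' q)    ≡⟨ sumMod-hard a b p' q ⟩
        addMod p' q                 ∎)
        where open ≡-Reasoning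

  signature : Quad → Fin n × Fin k
  signature (a , b , p , q) = state , hard a b p q (var state)
    where open LastQuery (critical a b p q)

  pick-and-sum : ∀ c {p q p' q' : Fin k} → pick c p q ≡ pick c p' q' →
                 addMod p q ≡ addMod p' q' → (p , q) ≡ (p' , q')
  pick-and-sum node₂ {p} {q} {.p} {q'} refl sum = cong (p ,_) (addMod-cancelˡ p q q' sum)
  pick-and-sum node₃ {p} {q} {p'} {.q} refl sum = cong (_, q) (addMod-cancelʳ p p' q sum)

  -- Two hard inputs for the same (a, b) whose last hidden queries are at the
  -- same state s, reading the same value there, have the same (p, q): the
  -- value read gives one of p, q, and the common output p + q the other.
  hard-determined : ∀ {a b p q p' q'} c s → var s ≡ nodeVar c a b →
    hard a b p q (var s) ≡ hard a b p' q' (var s) →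
    HaltsAvoiding (Hidden a b) (hard a b p q) (next s (hard a b p q (var s)))
                  (sumMod k (hard a b p q)) →
    Halts (hard a b p' q') (next s (hard a b p' q' (var s))) (sumMod k (hard a b p' q')) →
    (p , q) ≡ (p' , q')
  hard-determined {a} {b} {p} {q} {p'} {q'} c s at same-read rest rest' =
    pick-and-sum c read-equal sum-equal
    where
      open ≡-Reasoning
      x y : Var k → Fin k
      x = hard a b p q
      y = hard a b p' q'

      read-equal : pick c p q ≡ pick c p' q'
      read-equal = begin
        pick c p q          ≡⟨ sym (hard-hidden a b p q c) ⟩
        x (nodeVar c a b)   ≡⟨ cong x (sym at) ⟩
        x (var s)           ≡⟨ same-read ⟩
        y (var s)           ≡⟨ cong y at ⟩
        y (nodeVar c a b)   ≡⟨ hard-hidden a b p' q' c ⟩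
        pick c p' q'        ∎

      sum-equal : addMod p q ≡ addMod p' q'
      sum-equal = begin
        addMod p q    ≡⟨ sym (sumMod-hard a b p q) ⟩
        sumMod k x    ≡⟨ outputs-agree (hard-visible a b p q p' q') rest
                           (subst (λ w → Halts y (next s w) (sumMod k y)) (sym same-read) rest') ⟩
        sumMod k y    ≡⟨ sumMod-hard a b p' q' ⟩
        addMod p' q'  ∎

  signature-injective : ∀ {u u'} → signature u ≡ signature u' → u ≡ u'
  signature-injective {a , b , p , q} {a' , b' , p' , q'} same
    with critical a b p q | critical a' b' p' q'
  ... | lastQuery s (c , at) rest | lastQuery s' (c' , at') rest'
    with refl ← cong proj₁ same
    with refl , refl , refl ← nodeVar-injective (trans (sym at) at')
    with refl ← hard-determined c s at (cong proj₂ same) rest (forget rest')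
    = refl

  quadruples-bound : k * (k * (k * k)) ≤ n * k
  quadruples-bound = injection⇒≤
    ((↔-refl ×-↔ (↔-refl ×-↔ Fin.*↔×)) ↔-∘ ((↔-refl ×-↔ Fin.*↔×) ↔-∘ Fin.*↔×))
    Fin.*↔×
    (mk↣ signature-injective)

  states-bound : k ^ 3 ≤ numStates P
  states-bound = ≤-trans
    (*-cancelʳ-≤ (k ^ 3) n k (subst (_≤ n * k) (fourth-power k) quadruples-bound))
    (m≤m+n n k)
    where
      fourth-power : ∀ x → x * (x * (x * x)) ≡ x ^ 3 * x
      fourth-power x = trans (cong (λ w → x * (x * (x * w))) (sym (*-identityʳ x)))
                             (*-comm x (x ^ 3))

theorem5p9 : (k : ℕ) → 2 ≤ k → (P : BP k (Var k) k) →
    Computes P (sumMod k) → k ^ 3 ≤ numStates P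
theorem5p9 (suc (suc m)) _ P computes = LowerBound.states-bound m P computes
theorem5p9 (suc zero) (s≤s ()) P computes
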